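{- Consider the octonions $A_3$ with canonical basis $e_0,\dots,e_7$, and the point-line geometry $\Pi_3$ whose points are the seven imaginary units $e_1,\dots,e_7$ and whose lines are the distinguished triples. Then $\Pi_3$ has exactly one defective triple, namely $\{e_3,e_5,e_6\}$, and six ordinary triples. The Pasch configuration $\mathcal{P}$ has exactly seven geometric hyperplanes: three of them consist of two non-collinear points, and four of them are the point sets of the lines of $\mathcal{P}$. Moreover, there is a bijection $\varphi$ from $\{e_1,\dots,e_7\}$ onto the set of geometric hyperplanes of $\mathcal{P}$ with the following two properties. (i) Three distinct units $e_a,e_b,e_c$ form a distinguished triple if and only if $\{\varphi(e_a),\varphi(e_b),\varphi(e_c)\}$ is a line of the Veldkamp space $\mathcal{V}(\mathcal{P})$. In particular, $\mathcal{V}(\mathcal{P})\cong \mathrm{PG}(2,2)$. (ii) $\varphi$ maps $e_3,e_5,e_6$, the units lying on the defective triple, to the three hyperplanes consisting of two non-collinear points. It maps $e_1,e_2,e_4,e_7$, the units lying only on ordinary triples, to the four hyperplanes that are lines of $\mathcal{P}$.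
   Context: Cayley-Dickson algebras are defined recursively by $A_0=\mathbb{R}$ and $A_{N+1}=A_N\times A_N$. On $A_{N+1}$, conjugation is $(x,y)^*=(x^*,-y)$ and multiplication is $(x,y)(X,Y)=(xX-Yy^*,\,x^*Y+Xy)$. The canonical basis $e_0,\dots,e_{2^{N+1}-1}$ of $A_{N+1}$ is given by $e_i=(e_i,0)$ and $e_{2^N+i}=(0,e_i)$ for $0\le i\le 2^N-1$. On the right-hand side, $e_i$ denotes the canonical basis of $A_N$; the basis of $A_0$ is $e_0=1$. The octonions are $A_3$. The imaginary units of $A_N$ are $e_1,\dots,e_{2^N-1}$. A distinguished triple is a set $\{e_a,e_b,e_c\}$ of three distinct imaginary units with $e_ae_b=\pm e_c$. Write the indices so that $a<b<c$. The triple is called ordinary if $a+b=c$ and defective if $a+b\neq c$. A point-line incidence structure consists of finite sets of points and lines together with an incidence relation. A geometric hyperplane of such a structure is a proper subset $H$ of the point set such that every line either has all its points in $H$ or has exactly one point in $H$. The Veldkamp space $\mathcal{V}(\mathcal{C})$ of a structure $\mathcal{C}$ is defined as follows. Its points are the geometric hyperplanes of $\mathcal{C}$. For distinct hyperplanes $H',H''$, the Veldkamp line through them is the set of all hyperplanes $H$ such that $H\in\{H',H''\}$ or $H'\cap H''=H'\cap H=H''\cap H$. The Pasch configuration is the unique $(6_2,4_3)$-configuration: 6 points, 4 lines, 3 points per line, 2 lines per point. Equivalently, it is the structure whose points are the 2-element subsets of $\{1,2,3,4\}$ and whose lines are the 3-element subsets of $\{1,2,3,4\}$. A point lies on a line when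 the 2-subset is contained in the 3-subset. $\mathrm{PG}(n,2)$ denotes the $n$-dimensional projective space over the field with two elements. -}

module Defs where

open import Data.Nat as ℕ using (ℕ; zero; suc; _<ᵇ_; _∸_; _^_)
open import Data.Integer as ℤ using (ℤ; 0ℤ; 1ℤ)
open import Data.Bool using (Bool; true; false; if_then_else_; _∧_; _∨_; _xor_)
open import Data.Fin using (Fin; zero; suc; toℕ; _<_; #_)
open import Data.Fin.Subset using (Subset; _∈_; _∉_; _∩_)
open import Data.Vec using (Vec; tabulate; zipWith; replicate)
open import Data.Product using (Σ; ∃; _×_; _,_)
open import Data.Sum using (_⊎_)
open import Relation.Binary.PropositionalEquality using (_≡_; _≢_)
open import Relation.Nullary using (¬_)
open import Function using (_⇔_)
open import Function.Definitions using (Injective)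

-- Cayley–Dickson algebras A_N (over ℤ; the basis elements and their
-- products only involve integer coordinates, so this is the ℤ-form
-- of A_N, which embeds in the real algebra with the same formulas).

CD : ℕ → Set
CD zero    = ℤ
CD (suc n) = CD n × CD n

cd0 : ∀ n → CD n
cd0 zero    = 0ℤ
cd0 (suc n) = cd0 n , cd0 n

cdAdd : ∀ n → CD n → CD n → CD n
cdAdd zero    x y = x ℤ.+ y
cdAdd (suc n) (x , y) (X , Y) = cdAdd n x X , cdAdd n y Y

cdNeg : ∀ n → CD n → CD n
cdNeg zero    x = ℤ.- x
cdNeg (suc n) (x , y) = cdNeg n x , cdNeg n y

cdConj : ∀ n → CD n → CD n
cdConj zero    x = x
cdConj (suc n) (x , y) = cdConj n x , cdNeg n y

cdMul : ∀ n → CD n → CD n → CD n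
cdMul zero    x y = x ℤ.* y
cdMul (suc n) (x , y) (X , Y) =
  cdAdd n (cdMul n x X) (cdNeg n (cdMul n Y (cdConj n y))) ,
  cdAdd n (cdMul n (cdConj n x) Y) (cdMul n X y)

basis : ∀ n → ℕ → CD n
basis zero    zero    = 1ℤ
basis zero    (suc _) = 0ℤ
basis (suc n) i =
  if i <ᵇ 2 ^ n then (basis n i , cd0 n) else (cd0 n , basis n (i ∸ 2 ^ n))

Oct : Set
Oct = CD 3

e : Fin 8 → Oct
e i = basis 3 (toℕ i)

_·_ : Oct → Oct → Oct
x · y = cdMul 3 x y

-ₒ_ : Oct → Oct
-ₒ x = cdNeg 3 x

ProdPM : Fin 8 → Fin 8 → Fin 8 → Set
ProdPM x y z = (e x · e y ≡ e z) ⊎ (e x · e y ≡ -ₒ e z)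

DistinguishedSet : Fin 8 → Fin 8 → Fin 8 → Set
DistinguishedSet a b c =
  a ≢ zero × b ≢ zero × c ≢ zero × a ≢ b × a ≢ c × b ≢ c ×
  (ProdPM a b c ⊎ ProdPM b a c ⊎ ProdPM a c b ⊎
   ProdPM c a b ⊎ ProdPM b c a ⊎ ProdPM c b a)

DistTriple : Fin 8 × Fin 8 × Fin 8 → Set
DistTriple (a , b , c) = a < b × b < c × DistinguishedSet a b c

Ordinary : Fin 8 × Fin 8 × Fin 8 → Set
Ordinary t@(a , b , c) = DistTriple t × (toℕ a ℕ.+ toℕ b ≡ toℕ c)

Defective : Fin 8 × Fin 8 × Fin 8 → Set
Defective t@(a , b , c) = DistTriple t × (toℕ a ℕ.+ toℕ b ≢ toℕ c)

HasExactly : ∀ {A : Set} → ℕ → (A → Set) → Set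
HasExactly {A} k P =
  Σ (Fin k → A) λ f →
    (∀ i → P (f i)) × Injective _≡_ _≡_ f × (∀ x → P x → ∃ λ i → f i ≡ x)

-- The Pasch configuration: points = 2-subsets of {0,1,2,3},
-- lines = 3-subsets, incidence = containment.

pairOf : Fin 6 → Fin 4 × Fin 4
pairOf zero                         = # 0 , # 1
pairOf (suc zero)                   = # 0 , # 2
pairOf (suc (suc zero))             = # 0 , # 3
pairOf (suc (suc (suc zero)))       = # 1 , # 2
pairOf (suc (suc (suc (suc zero)))) = # 1 , # 3
pairOf (suc (suc (suc (suc (suc zero))))) = # 2 , # 3

tripleOf : Fin 4 → Fin 4 × Fin 4 × Fin 4
tripleOf zero                   = # 0 , # 1 , # 2
tripleOf (suc zero)             = # 0 , # 1 , # 3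
tripleOf (suc (suc zero))       = # 0 , # 2 , # 3
tripleOf (suc (suc (suc zero))) = # 1 , # 2 , # 3

_==_ : ∀ {n} → Fin n → Fin n → Bool
zero  == zero  = true
zero  == suc _ = false
suc _ == zero  = false
suc i == suc j = i == j

memb : Fin 4 → Fin 4 × Fin 4 × Fin 4 → Bool
memb x (i , j , k) = (x == i) ∨ (x == j) ∨ (x == k)

inc : Fin 6 → Fin 4 → Bool
inc p l with pairOf p
... | (i , j) = memb i (tripleOf l) ∧ memb j (tripleOf l)

Incident : Fin 6 → Fin 4 → Set
Incident p l = inc p l ≡ true

pointsOf : Fin 4 → Subset 6
pointsOf l = tabulate (λ p → inc p l)

IsHyperplane : Subset 6 → Set
IsHyperplane H =
  (∃ λ p → p ∉ H) ×
  (∀ l → (∀ p → Incident p l → p ∈ H) ⊎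
         (∃ λ p → Incident p l × p ∈ H ×
                  (∀ q → Incident q l → q ∈ H → q ≡ p)))

Collinear : Fin 6 → Fin 6 → Set
Collinear p q = ∃ λ l → Incident p l × Incident q l

TwoNonCollinear : Subset 6 → Set
TwoNonCollinear H =
  ∃ λ p → ∃ λ q → p ≢ q × ¬ Collinear p q × (∀ r → r ∈ H ⇔ (r ≡ p ⊎ r ≡ q))

IsLineSet : Subset 6 → Set
IsLineSet H = ∃ λ l → H ≡ pointsOf l

OnVLine : Subset 6 → Subset 6 → Subset 6 → Set
OnVLine H' H'' H =
  H ≡ H' ⊎ H ≡ H'' ⊎ ((H' ∩ H'' ≡ H' ∩ H) × (H' ∩ H ≡ H'' ∩ H))

IsVLineSet3 : Subset 6 → Subset 6 → Subset 6 → Set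
IsVLineSet3 A B C =
  ∃ λ H' → ∃ λ H'' → IsHyperplane H' × IsHyperplane H'' × H' ≢ H'' ×
    (∀ H → IsHyperplane H → (OnVLine H' H'' H ⇔ (H ≡ A ⊎ H ≡ B ⊎ H ≡ C)))

F2³ : Set
F2³ = Vec Bool 3

zero₃ : F2³
zero₃ = replicate 3 false

_⊕_ : F2³ → F2³ → F2³
_⊕_ = zipWith _xor_

PGLine : F2³ → F2³ → F2³ → Set
PGLine x y z =
  x ≢ zero₃ × y ≢ zero₃ × z ≢ zero₃ × x ≢ y × x ≢ z × y ≢ z ×
  (x ⊕ y) ⊕ z ≡ zero₃

VeldkampIsoPG22 : Set
VeldkampIsoPG22 =
  Σ (F2³ → Subset 6) λ ψ →
    (∀ x → x ≢ zero₃ → IsHyperplane (ψ x)) ×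
    (∀ x y → x ≢ zero₃ → y ≢ zero₃ → ψ x ≡ ψ y → x ≡ y) ×
    (∀ H → IsHyperplane H → ∃ λ x → x ≢ zero₃ × ψ x ≡ H) ×
    (∀ x y z → PGLine x y z → IsVLineSet3 (ψ x) (ψ y) (ψ z)) ×
    (∀ H' H'' → IsHyperplane H' → IsHyperplane H'' → H' ≢ H'' →
       ∃ λ x → ∃ λ y → ∃ λ z → PGLine x y z ×
         (∀ H → IsHyperplane H → (OnVLine H' H'' H ⇔ (H ≡ ψ x ⊎ H ≡ ψ y ⊎ H ≡ ψ z))))

-- Every object in the theorem is finite and every predicate is decidable:
-- octonion products of basis units are integer vectors that can be compared,
-- and the Pasch configuration has only 2⁶ candidate point sets.
--
-- The one non-local step is the classification of hyperplanes: once we know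
-- that φ e₁, …, φ e₇ are hyperplanes and that every hyperplane is one of
-- them, statements quantifying over all hyperplanes (such as membership in a
-- Veldkamp line) reduce to statements about seven sets, and become decidable.
-- Part (i) is then a single finite check.  The isomorphism V(P) ≅ PG(2,2)
-- follows by labelling e_a with the binary digits of a: the lines of PG(2,2)
-- are then exactly the distinguished triples, and (i) transfers.

module Submission where

open import Defs
open import Data.Fin using (Fin; zero; suc; toℕ; #_)
open import Data.Fin.Subset using (Subset; _∩_)
open import Data.Fin.Subset.Properties using (_∈?_; anySubset?)
open import Data.Fin.Properties as Finₚ using (all?; any?)
import Data.Nat as ℕ
import Data.Nat.Properties as ℕₚ
import Data.Integer.Properties as ℤₚ
open import Data.Bool using (Bool; true; false)
import Data.Bool.Properties as Boolₚ
open import Data.Vec using (Vec; []; _∷_)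
import Data.Vec.Properties as Vecₚ
import Data.Product.Properties as Productₚ
open import Data.Product using (Σ; ∃; _×_; _,_; proj₁; proj₂)
open import Data.Sum using (_⊎_)
open import Relation.Binary.PropositionalEquality using (_≡_; _≢_; refl; sym; trans; cong)
open import Data.Empty using (⊥-elim)
open import Relation.Binary.Definitions using (DecidableEquality)
open import Relation.Nullary using (Dec)
open import Relation.Nullary.Decidable
  using (_×-dec_; _⊎-dec_; _→-dec_; ¬?; map′; toWitness; decidable-stable)
open import Function using (_⇔_; mk⇔; Equivalence)

infixr 2 _⇔?_
_⇔?_ : ∀ {P Q : Set} → Dec P → Dec Q → Dec (P ⇔ Q)
p? ⇔? q? = map′ (λ (to , from) → mk⇔ to from)
                (λ h → Equivalence.to h , Equivalence.from h)
                ((p? →-dec q?) ×-dec (q? →-dec p?))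

-- Universal quantification over the subsets of a finite set (equivalently,
-- over Boolean vectors) is decidable: refute a counterexample.
allSubsets? : ∀ {n} {P : Subset n → Set} → (∀ X → Dec (P X)) → Dec (∀ X → P X)
allSubsets? P? = map′ (λ ¬counterexample X → decidable-stable (P? X) (λ ¬p → ¬counterexample (X , ¬p)))
                      (λ all (X , ¬p) → ¬p (all X))
                      (¬? (anySubset? (λ X → ¬? (P? X))))

_≟ᵥ_ : ∀ {n} → DecidableEquality (Vec Bool n)
_≟ᵥ_ = Vecₚ.≡-dec Boolₚ._≟_

_≢?_ : ∀ {n} (a b : Fin n) → Dec (a ≢ b)
a ≢? b = ¬? (a Finₚ.≟ b)

enumeration : ∀ {A : Set} {k} {P : A → Set} (f : Fin k → A) →
  (∀ i → P (f i)) → (∀ i j → f i ≡ f j → i ≡ j) →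
  (∀ x → P x → ∃ λ i → f i ≡ x) → HasExactly k P
enumeration f listed injective complete = f , listed , (λ {i} {j} → injective i j) , complete

injective? : ∀ {A : Set} {k} → DecidableEquality A → (f : Fin k → A) →
  Dec (∀ i j → f i ≡ f j → i ≡ j)
injective? _≟_ f = all? (λ i → all? (λ j → (f i ≟ f j) →-dec (i Finₚ.≟ j)))

_≟CD_ : ∀ {n} → DecidableEquality (CD n)
_≟CD_ {ℕ.zero}  = ℤₚ._≟_
_≟CD_ {ℕ.suc n} = Productₚ.≡-dec _≟CD_ _≟CD_

prodPM? : ∀ x y z → Dec (ProdPM x y z)
prodPM? x y z = ((e x · e y) ≟CD e z) ⊎-dec ((e x · e y) ≟CD (-ₒ e z))

distinguished? : ∀ a b c → Dec (DistinguishedSet a b c)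
distinguished? a b c =
  (a ≢? zero) ×-dec (b ≢? zero) ×-dec (c ≢? zero) ×-dec
  (a ≢? b) ×-dec (a ≢? c) ×-dec (b ≢? c) ×-dec
  (prodPM? a b c ⊎-dec prodPM? b a c ⊎-dec prodPM? a c b ⊎-dec
   prodPM? c a b ⊎-dec prodPM? b c a ⊎-dec prodPM? c b a)

Triple : Set
Triple = Fin 8 × Fin 8 × Fin 8

_≟T_ : DecidableEquality Triple
_≟T_ = Productₚ.≡-dec Finₚ._≟_ (Productₚ.≡-dec Finₚ._≟_ Finₚ._≟_)

allTriples? : ∀ {P : Triple → Set} → (∀ t → Dec (P t)) → Dec (∀ t → P t)
allTriples? P? = map′ (λ all (a , b , c) → all a b c) (λ all a b c → all (a , b , c))
  (all? (λ a → all? (λ b → all? (λ c → P? (a , b , c)))))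

distTriple? : ∀ t → Dec (DistTriple t)
distTriple? (a , b , c) = (a Finₚ.<? b) ×-dec (b Finₚ.<? c) ×-dec distinguished? a b c

ordinary? : ∀ t → Dec (Ordinary t)
ordinary? t@(a , b , c) = distTriple? t ×-dec (toℕ a ℕ.+ toℕ b ℕₚ.≟ toℕ c)

defective? : ∀ t → Dec (Defective t)
defective? t@(a , b , c) = distTriple? t ×-dec ¬? (toℕ a ℕ.+ toℕ b ℕₚ.≟ toℕ c)

defectiveTriple : ∀ t → Defective t ⇔ (t ≡ (# 3 , # 5 , # 6))
defectiveTriple = toWitness {a? = allTriples? (λ t → defective? t ⇔? (t ≟T (# 3 , # 5 , # 6)))} _

ordinaryTriple : Fin 6 → Triple
ordinaryTriple zero                               = # 1 , # 2 , # 3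
ordinaryTriple (suc zero)                         = # 1 , # 4 , # 5
ordinaryTriple (suc (suc zero))                   = # 1 , # 6 , # 7
ordinaryTriple (suc (suc (suc zero)))             = # 2 , # 4 , # 6
ordinaryTriple (suc (suc (suc (suc zero))))       = # 2 , # 5 , # 7
ordinaryTriple (suc (suc (suc (suc (suc zero))))) = # 3 , # 4 , # 7

ordinaryTriples : HasExactly 6 Ordinary
ordinaryTriples = enumeration ordinaryTriple
  (toWitness {a? = all? (λ i → ordinary? (ordinaryTriple i))} _)
  (toWitness {a? = injective? _≟T_ ordinaryTriple} _)
  (toWitness {a? = allTriples? (λ t → ordinary? t →-dec any? (λ i → ordinaryTriple i ≟T t))} _)

incident? : ∀ p l → Dec (Incident p l)
incident? p l = inc p l Boolₚ.≟ true

isHyperplane? : ∀ H → Dec (IsHyperplane H)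
isHyperplane? H =
  any? (λ p → ¬? (p ∈? H)) ×-dec
  all? (λ l → all? (λ p → incident? p l →-dec p ∈? H) ⊎-dec
              any? (λ p → incident? p l ×-dec p ∈? H ×-dec
                          all? (λ q → incident? q l →-dec q ∈? H →-dec q Finₚ.≟ p)))

collinear? : ∀ p q → Dec (Collinear p q)
collinear? p q = any? (λ l → incident? p l ×-dec incident? q l)

twoNonCollinear? : ∀ H → Dec (TwoNonCollinear H)
twoNonCollinear? H = any? (λ p → any? (λ q →
  (p ≢? q) ×-dec ¬? (collinear? p q) ×-dec
  all? (λ r → (r ∈? H) ⇔? ((r Finₚ.≟ p) ⊎-dec (r Finₚ.≟ q)))))

isLineSet? : ∀ H → Dec (IsLineSet H)
isLineSet? H = any? (λ l → H ≟ᵥ pointsOf l)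

onVLine? : ∀ H' H'' H → Dec (OnVLine H' H'' H)
onVLine? H' H'' H = (H ≟ᵥ H') ⊎-dec (H ≟ᵥ H'') ⊎-dec
  (((H' ∩ H'') ≟ᵥ (H' ∩ H)) ×-dec ((H' ∩ H) ≟ᵥ (H'' ∩ H)))

-- φ e_a for a ≠ 0, as a characteristic vector over the points
-- {0,1},{0,2},{0,3},{1,2},{1,3},{2,3}; the value at e₀ is irrelevant.
φ : Fin 8 → Subset 6
φ zero                                            = true  ∷ true  ∷ true  ∷ true  ∷ true  ∷ true  ∷ []
φ (suc zero)                                      = true  ∷ true  ∷ false ∷ true  ∷ false ∷ false ∷ []
φ (suc (suc zero))                                = false ∷ false ∷ false ∷ true  ∷ true  ∷ true  ∷ []
φ (suc (suc (suc zero)))                          = false ∷ false ∷ true  ∷ true  ∷ false ∷ false ∷ []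
φ (suc (suc (suc (suc zero))))                    = true  ∷ false ∷ true  ∷ false ∷ true  ∷ false ∷ []
φ (suc (suc (suc (suc (suc zero)))))              = true  ∷ false ∷ false ∷ false ∷ false ∷ true  ∷ []
φ (suc (suc (suc (suc (suc (suc zero))))))        = false ∷ true  ∷ false ∷ false ∷ true  ∷ false ∷ []
φ (suc (suc (suc (suc (suc (suc (suc zero))))))) = false ∷ true  ∷ true  ∷ false ∷ false ∷ true  ∷ []

hyperplane : Fin 7 → Subset 6
hyperplane k = φ (suc k)

abstract
  hyperplane-valid : ∀ k → IsHyperplane (hyperplane k)
  hyperplane-valid = toWitness {a? = all? (λ k → isHyperplane? (hyperplane k))} _

  hyperplane-injective : ∀ i j → hyperplane i ≡ hyperplane j → i ≡ j
  hyperplane-injective = toWitness {a? = injective? _≟ᵥ_ hyperplane} _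

  hyperplane-complete : ∀ H → IsHyperplane H → ∃ λ k → hyperplane k ≡ H
  hyperplane-complete = toWitness {a? = allSubsets? (λ H → isHyperplane? H →-dec
                                                            any? (λ k → hyperplane k ≟ᵥ H))} _

-- Quantifiers over hyperplanes reduce to quantifiers over the seven indices,
-- hence are decidable for decidable properties.
allHyperplanes? : ∀ {P : Subset 6 → Set} → (∀ H → Dec (P H)) →
  Dec (∀ H → IsHyperplane H → P H)
allHyperplanes? {P} P? = map′ fromIndices (λ all k → all (hyperplane k) (hyperplane-valid k))
                              (all? (λ k → P? (hyperplane k)))
  where
  fromIndices : (∀ k → P (hyperplane k)) → ∀ H → IsHyperplane H → P H
  fromIndices all H isH with hyperplane-complete H isH
  ... | k , refl = all k

anyHyperplane? : ∀ {P : Subset 6 → Set} → (∀ H → Dec (P H)) →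
  Dec (∃ λ H → IsHyperplane H × P H)
anyHyperplane? {P} P? = map′ (λ (k , p) → hyperplane k , hyperplane-valid k , p)
                         (λ (H , isH , p) → fromHyperplane H isH p)
                         (any? (λ k → P? (hyperplane k)))
  where
  fromHyperplane : ∀ H → IsHyperplane H → P H → ∃ λ k → P (hyperplane k)
  fromHyperplane H isH p with hyperplane-complete H isH
  ... | k , refl = k , p

φ-valid : ∀ a → a ≢ zero → IsHyperplane (φ a)
φ-valid zero    a≢0 = ⊥-elim (a≢0 refl)
φ-valid (suc k) _   = hyperplane-valid k

φ-injective : ∀ a b → a ≢ zero → b ≢ zero → φ a ≡ φ b → a ≡ b
φ-injective zero    _       a≢0 _   _  = ⊥-elim (a≢0 refl)
φ-injective (suc _) zero    _   b≢0 _  = ⊥-elim (b≢0 refl)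
φ-injective (suc i) (suc j) _   _   eq = cong suc (hyperplane-injective i j eq)

φ-surjective : ∀ H → IsHyperplane H → ∃ λ a → a ≢ zero × φ a ≡ H
φ-surjective H isH with hyperplane-complete H isH
... | k , eq = suc k , (λ ()) , eq

hyperplanes : HasExactly 7 IsHyperplane
hyperplanes = enumeration hyperplane hyperplane-valid hyperplane-injective hyperplane-complete

hyperplaneTypes : ∀ H → IsHyperplane H ⇔ (TwoNonCollinear H ⊎ IsLineSet H)
hyperplaneTypes = toWitness {a? = allSubsets? (λ H →
  isHyperplane? H ⇔? (twoNonCollinear? H ⊎-dec isLineSet? H))} _

defectiveUnit : Fin 3 → Fin 8
defectiveUnit zero             = # 3
defectiveUnit (suc zero)       = # 5
defectiveUnit (suc (suc zero)) = # 6

ordinaryUnit : Fin 4 → Fin 8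
ordinaryUnit zero                   = # 1
ordinaryUnit (suc zero)             = # 2
ordinaryUnit (suc (suc zero))       = # 4
ordinaryUnit (suc (suc (suc zero))) = # 7

-- Hyperplanes of a decidable kind Q are counted by a listing of them; by the
-- classification, completeness of the listing is a check on seven sets.
hyperplanesOfKind : ∀ {k} {Q : Subset 6 → Set} (f : Fin k → Subset 6) →
  (∀ i → IsHyperplane (f i) × Q (f i)) → (∀ i j → f i ≡ f j → i ≡ j) →
  (∀ H → IsHyperplane H → Q H → ∃ λ i → f i ≡ H) →
  HasExactly k (λ H → IsHyperplane H × Q H)
hyperplanesOfKind f listed injective complete =
  enumeration f listed injective (λ H (isH , q) → complete H isH q)

twoPointHyperplanes : HasExactly 3 (λ H → IsHyperplane H × TwoNonCollinear H)
twoPointHyperplanes = hyperplanesOfKind (λ i → φ (defectiveUnit i))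
  (toWitness {a? = all? (λ i → isHyperplane? (φ (defectiveUnit i)) ×-dec twoNonCollinear? (φ (defectiveUnit i)))} _)
  (toWitness {a? = injective? _≟ᵥ_ (λ i → φ (defectiveUnit i))} _)
  (toWitness {a? = allHyperplanes? (λ H → twoNonCollinear? H →-dec any? (λ i → φ (defectiveUnit i) ≟ᵥ H))} _)

lineHyperplanes : HasExactly 4 (λ H → IsHyperplane H × IsLineSet H)
lineHyperplanes = hyperplanesOfKind (λ i → φ (ordinaryUnit i))
  (toWitness {a? = all? (λ i → isHyperplane? (φ (ordinaryUnit i)) ×-dec isLineSet? (φ (ordinaryUnit i)))} _)
  (toWitness {a? = injective? _≟ᵥ_ (λ i → φ (ordinaryUnit i))} _)
  (toWitness {a? = allHyperplanes? (λ H → isLineSet? H →-dec any? (λ i → φ (ordinaryUnit i) ≟ᵥ H))} _)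

-- Membership in a Veldkamp line and the existence of the two spanning
-- hyperplanes only quantify over hyperplanes, so IsVLineSet3 is decidable.
isVLineSet3? : ∀ A B C → Dec (IsVLineSet3 A B C)
isVLineSet3? A B C =
  map′ (λ (H' , isH' , H'' , isH'' , H'≢H'' , line) → H' , H'' , isH' , isH'' , H'≢H'' , line)
       (λ (H' , H'' , isH' , isH'' , H'≢H'' , line) → H' , isH' , H'' , isH'' , H'≢H'' , line)
       (anyHyperplane? (λ H' → anyHyperplane? (λ H'' → ¬? (H' ≟ᵥ H'') ×-dec
          allHyperplanes? (λ H → onVLine? H' H'' H ⇔? ((H ≟ᵥ A) ⊎-dec (H ≟ᵥ B) ⊎-dec (H ≟ᵥ C))))))

abstract
  distinguished⇔veldkampLine : ∀ a b c → a ≢ zero → b ≢ zero → c ≢ zero → a ≢ b → a ≢ c → b ≢ c →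
    DistinguishedSet a b c ⇔ IsVLineSet3 (φ a) (φ b) (φ c)
  distinguished⇔veldkampLine = toWitness {a? = all? (λ a → all? (λ b → all? (λ c →
    (a ≢? zero) →-dec (b ≢? zero) →-dec (c ≢? zero) →-dec (a ≢? b) →-dec (a ≢? c) →-dec (b ≢? c) →-dec
    (distinguished? a b c ⇔? isVLineSet3? (φ a) (φ b) (φ c)))))} _

-- the distinctness hypotheses of (i) are part of being distinguished
distinguished→veldkampLine : ∀ a b c → DistinguishedSet a b c → IsVLineSet3 (φ a) (φ b) (φ c)
distinguished→veldkampLine a b c d@(a≢0 , b≢0 , c≢0 , a≢b , a≢c , b≢c , _) =
  Equivalence.to (distinguished⇔veldkampLine a b c a≢0 b≢0 c≢0 a≢b a≢c b≢c) d

binary : Fin 8 → F2³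
binary zero                                            = false ∷ false ∷ false ∷ []
binary (suc zero)                                      = false ∷ false ∷ true  ∷ []
binary (suc (suc zero))                                = false ∷ true  ∷ false ∷ []
binary (suc (suc (suc zero)))                          = false ∷ true  ∷ true  ∷ []
binary (suc (suc (suc (suc zero))))                    = true  ∷ false ∷ false ∷ []
binary (suc (suc (suc (suc (suc zero)))))              = true  ∷ false ∷ true  ∷ []
binary (suc (suc (suc (suc (suc (suc zero))))))        = true  ∷ true  ∷ false ∷ []
binary (suc (suc (suc (suc (suc (suc (suc zero))))))) = true  ∷ true  ∷ true  ∷ []

fromBinary : F2³ → Fin 8
fromBinary (false ∷ false ∷ false ∷ []) = # 0
fromBinary (false ∷ false ∷ true  ∷ []) = # 1
fromBinary (false ∷ true  ∷ false ∷ []) = # 2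
fromBinary (false ∷ true  ∷ true  ∷ []) = # 3
fromBinary (true  ∷ false ∷ false ∷ []) = # 4
fromBinary (true  ∷ false ∷ true  ∷ []) = # 5
fromBinary (true  ∷ true  ∷ false ∷ []) = # 6
fromBinary (true  ∷ true  ∷ true  ∷ []) = # 7

fromBinary-binary : ∀ a → fromBinary (binary a) ≡ a
fromBinary-binary = toWitness {a? = all? (λ a → fromBinary (binary a) Finₚ.≟ a)} _

binary-fromBinary : ∀ x → binary (fromBinary x) ≡ x
binary-fromBinary = toWitness {a? = allSubsets? (λ x → binary (fromBinary x) ≟ᵥ x)} _

binary-nonzero : ∀ a → a ≢ zero → binary a ≢ zero₃
binary-nonzero a a≢0 eq = a≢0 (trans (sym (fromBinary-binary a)) (cong fromBinary eq))

fromBinary-nonzero : ∀ x → x ≢ zero₃ → fromBinary x ≢ zero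
fromBinary-nonzero x x≢0 eq = x≢0 (trans (sym (binary-fromBinary x)) (cong binary eq))

pgLine? : ∀ x y z → Dec (PGLine x y z)
pgLine? x y z = ¬? (x ≟ᵥ zero₃) ×-dec ¬? (y ≟ᵥ zero₃) ×-dec ¬? (z ≟ᵥ zero₃) ×-dec
  ¬? (x ≟ᵥ y) ×-dec ¬? (x ≟ᵥ z) ×-dec ¬? (y ≟ᵥ z) ×-dec (((x ⊕ y) ⊕ z) ≟ᵥ zero₃)

ψ : F2³ → Subset 6
ψ x = φ (fromBinary x)

abstract
  pgLine→distinguished : ∀ x y z → PGLine x y z →
    DistinguishedSet (fromBinary x) (fromBinary y) (fromBinary z)
  pgLine→distinguished = toWitness {a? = allSubsets? (λ x → allSubsets? (λ y → allSubsets? (λ z →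
    pgLine? x y z →-dec distinguished? (fromBinary x) (fromBinary y) (fromBinary z))))} _

abstract
  veldkampLineThrough : ∀ x y → x ≢ zero₃ → y ≢ zero₃ → x ≢ y →
    PGLine x y (x ⊕ y) ×
    (∀ H → IsHyperplane H → OnVLine (ψ x) (ψ y) H ⇔ (H ≡ ψ x ⊎ H ≡ ψ y ⊎ H ≡ ψ (x ⊕ y)))
  veldkampLineThrough = toWitness {a? = allSubsets? (λ x → allSubsets? (λ y →
    ¬? (x ≟ᵥ zero₃) →-dec ¬? (y ≟ᵥ zero₃) →-dec ¬? (x ≟ᵥ y) →-dec
    (pgLine? x y (x ⊕ y) ×-dec allHyperplanes? (λ H → onVLine? (ψ x) (ψ y) H ⇔?
       ((H ≟ᵥ ψ x) ⊎-dec (H ≟ᵥ ψ y) ⊎-dec (H ≟ᵥ ψ (x ⊕ y)))))))} _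

ψ-valid : ∀ x → x ≢ zero₃ → IsHyperplane (ψ x)
ψ-valid x x≢0 = φ-valid (fromBinary x) (fromBinary-nonzero x x≢0)

ψ-injective : ∀ x y → x ≢ zero₃ → y ≢ zero₃ → ψ x ≡ ψ y → x ≡ y
ψ-injective x y x≢0 y≢0 eq =
  trans (sym (binary-fromBinary x))
    (trans (cong binary (φ-injective _ _ (fromBinary-nonzero x x≢0) (fromBinary-nonzero y y≢0) eq))
           (binary-fromBinary y))

ψ-lines : ∀ x y z → PGLine x y z → IsVLineSet3 (ψ x) (ψ y) (ψ z)
ψ-lines x y z line =
  distinguished→veldkampLine (fromBinary x) (fromBinary y) (fromBinary z) (pgLine→distinguished x y z line)

ψ-surjective : ∀ H → IsHyperplane H → ∃ λ x → x ≢ zero₃ × ψ x ≡ H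
ψ-surjective H isH with φ-surjective H isH
... | a , a≢0 , φa≡H = binary a , binary-nonzero a a≢0 , trans (cong φ (fromBinary-binary a)) φa≡H

ψ-spans : ∀ H' H'' → IsHyperplane H' → IsHyperplane H'' → H' ≢ H'' →
  ∃ λ x → ∃ λ y → ∃ λ z → PGLine x y z ×
    (∀ H → IsHyperplane H → (OnVLine H' H'' H ⇔ (H ≡ ψ x ⊎ H ≡ ψ y ⊎ H ≡ ψ z)))
ψ-spans H' H'' isH' isH'' H'≢H'' with ψ-surjective H' isH' | ψ-surjective H'' isH''
... | x , x≢0 , refl | y , y≢0 , refl =
  x , y , x ⊕ y , veldkampLineThrough x y x≢0 y≢0 (λ x≡y → H'≢H'' (cong ψ x≡y))

veldkampIsPG22 : VeldkampIsoPG22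
veldkampIsPG22 = ψ , ψ-valid , ψ-injective , ψ-surjective , ψ-lines , ψ-spans

mainTheorem1 :
    (∀ t → Defective t ⇔ (t ≡ (# 3 , # 5 , # 6))) ×
    HasExactly 6 Ordinary ×
    HasExactly 7 IsHyperplane ×
    (∀ H → IsHyperplane H ⇔ (TwoNonCollinear H ⊎ IsLineSet H)) ×
    HasExactly 3 (λ H → IsHyperplane H × TwoNonCollinear H) ×
    HasExactly 4 (λ H → IsHyperplane H × IsLineSet H) ×
    (Σ (Fin 8 → Subset 6) λ φ →
      (∀ a → a ≢ zero → IsHyperplane (φ a)) ×
      (∀ a b → a ≢ zero → b ≢ zero → φ a ≡ φ b → a ≡ b) ×
      (∀ H → IsHyperplane H → ∃ λ a → a ≢ zero × φ a ≡ H) ×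
      (∀ a b c → a ≢ zero → b ≢ zero → c ≢ zero → a ≢ b → a ≢ c → b ≢ c →
        DistinguishedSet a b c ⇔ IsVLineSet3 (φ a) (φ b) (φ c)) ×
      TwoNonCollinear (φ (# 3)) × TwoNonCollinear (φ (# 5)) × TwoNonCollinear (φ (# 6)) ×
      IsLineSet (φ (# 1)) × IsLineSet (φ (# 2)) × IsLineSet (φ (# 4)) × IsLineSet (φ (# 7))) ×
    VeldkampIsoPG22
mainTheorem1 =
  defectiveTriple , ordinaryTriples ,
  hyperplanes , hyperplaneTypes , twoPointHyperplanes , lineHyperplanes ,
  (φ , φ-valid , φ-injective , φ-surjective , distinguished⇔veldkampLine ,
   twoPoint (# 0) , twoPoint (# 1) , twoPoint (# 2) ,
   line (# 0) , line (# 1) , line (# 2) , line (# 3)) ,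
  veldkampIsPG22
  where
  twoPoint : ∀ i → TwoNonCollinear (φ (defectiveUnit i))
  twoPoint i = proj₂ (proj₁ (proj₂ twoPointHyperplanes) i)

  line : ∀ i → IsLineSet (φ (ordinaryUnit i))
  line i = proj₂ (proj₁ (proj₂ lineHyperplanes) i)
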